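{- Let $\mathcal D=\{0,1\}$ and let $F=(F_1,\dots,F_s):\mathcal D^{n}\times\mathcal D^{m}\to\mathcal D^{s}$ be Boolean functions $F_i(X_1,\dots,X_n,U_1,\dots,U_m)$. Let $\Omega\subset\mathcal D^{s}$ (the admissible set) and $W\subset\mathcal D^{n}$ (the restricted set) be given. Let $G=(G_1,\dots,G_m):\mathcal D^n\to\mathcal D^m$ be Boolean functions, defining $U_j=G_j(X_1,\dots,X_n)$, $j=1,\dots,m$, with structure matrix $M_G$, and let $T_\Omega$ be the truth matrix of $F$ with respect to $\Omega$. Then: (i) $G$ is a $W$-antecedence solution, i.e. for every $X\in W$, setting $U=G(X)$ gives $F(X,U)\in\Omega$, if and only if $M_G|_W\le T_\Omega|_W$ (entrywise); (ii) $G$ is a $W$-consequence solution, i.e. for every $X\in W$ and every $U\in\mathcal D^m$, $F(X,U)\in\Omega$ implies $U=G(X)$, if and only if $T_\Omega|_W\le M_G|_W$ (entrywise).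
   Context: Vector form: a logical variable $X\in\mathcal D$ is identified with $\vec X=(X,1-X)^{\mathrm T}$; $\delta_k^i$ denotes the $i$-th column of $I_k$ and $\Delta_k=\{\delta_k^1,\dots,\delta_k^k\}$. A tuple $X=(X_1,\dots,X_n)\in\mathcal D^n$ is identified with $x=\vec X_1\otimes\cdots\otimes\vec X_n\in\Delta_{2^n}$ (so $(1,\dots,1)\leftrightarrow\delta_{2^n}^1$, $(0,\dots,0)\leftrightarrow\delta_{2^n}^{2^n}$); similarly $U\in\mathcal D^m$ is identified with $u\in\Delta_{2^m}$. The structure matrix $M_G$ of $G:\mathcal D^n\to\mathcal D^m$ is the $2^m\times 2^n$ matrix whose $j$-th column is the vector form of $G(X)$, where $X$ is the state identified with $\delta_{2^n}^j$. The truth matrix $T_\Omega$ is the $2^m\times 2^n$ $0$–$1$ matrix whose $(i,j)$ entry is $1$ if $F(X,U)\in\Omega$ for $U\leftrightarrow\delta_{2^m}^i$, $X\leftrightarrow\delta_{2^n}^j$, and $0$ otherwise. For a $2^m\times 2^n$ matrix $A$, $A|_W$ denotes the submatrix obtained by deleting the columns corresponding to states $X\notin W$. For matrices $A,B$ of equal size, $A\le B$ means $A_{ij}\le B_{ij}$ for all $i,j$. -}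

module Defs where

open import Data.Bool using (Bool; true; false)
open import Data.Nat using (ℕ; zero; suc; _^_; _*_; _≤_)
open import Data.Fin using (Fin; zero; suc; remQuot)
open import Data.Product using (_,_)
open import Data.Vec using (Vec; []; _∷_)
open import Relation.Binary.PropositionalEquality using (_≡_)

-- 𝒟 = {0,1} is represented by Bool (true = 1, false = 0).
-- A state X ∈ 𝒟ⁿ is a Vec Bool n.

val : Bool → ℕ
val true  = 1
val false = 0

-- vector form  X⃗ = (X , 1 - X)ᵀ  as a function Fin 2 → ℕ
vecForm₁ : Bool → Fin 2 → ℕ
vecForm₁ true  zero       = 1
vecForm₁ true  (suc zero) = 0
vecForm₁ false zero       = 0
vecForm₁ false (suc zero) = 1

-- Kronecker product of a column vector of length 2 and one of length k:
-- (a ⊗ v)[i·k + j] = a i * v j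
kron : ∀ {k} → (Fin 2 → ℕ) → (Fin k → ℕ) → Fin (2 * k) → ℕ
kron {k} a v x with remQuot {2} k x
... | i , j = a i * v j

vecForm : ∀ {n} → Vec Bool n → Fin (2 ^ n) → ℕ
vecForm []       zero = 1
vecForm (X ∷ Xs) = kron (vecForm₁ X) (vecForm Xs)

δ : ∀ {k} → Fin k → Fin k → ℕ
δ zero    zero    = 1
δ zero    (suc _) = 0
δ (suc _) zero    = 0
δ (suc i) (suc j) = δ i j

-- the state X identified with δ_{2ⁿ}^j  (i.e. vecForm (state j) = δ j);
-- first block of the Kronecker product corresponds to Xᵢ = 1
state : ∀ {n} → Fin (2 ^ n) → Vec Bool n
state {zero}  _ = []
state {suc n} j with remQuot {2} (2 ^ n) j
... | zero     , r = true  ∷ state r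
... | suc zero , r = false ∷ state r

structMatrix : ∀ {n m} → (Vec Bool n → Vec Bool m) → Fin (2 ^ m) → Fin (2 ^ n) → ℕ
structMatrix G i j = vecForm (G (state j)) i

-- truth matrix T_Ω : entry (i,j) is 1 iff F(state j, state i) ∈ Ω
-- (Ω ⊆ 𝒟ˢ given by its characteristic function)
truthMatrix : ∀ {n m s} → (Vec Bool n → Vec Bool m → Vec Bool s) →
              (Vec Bool s → Bool) → Fin (2 ^ m) → Fin (2 ^ n) → ℕ
truthMatrix F Ω i j = val (Ω (F (state j) (state i)))

_≤_on_ : ∀ {n m} → (Fin (2 ^ m) → Fin (2 ^ n) → ℕ) → (Fin (2 ^ m) → Fin (2 ^ n) → ℕ) →
         (Vec Bool n → Bool) → Set
_≤_on_ A B W = ∀ i j → W (state j) ≡ true → A i j ≤ B i j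

IsAntecedence : ∀ {n m s} → (Vec Bool n → Vec Bool m → Vec Bool s) →
                (Vec Bool s → Bool) → (Vec Bool n → Bool) → (Vec Bool n → Vec Bool m) → Set
IsAntecedence F Ω W G = ∀ X → W X ≡ true → Ω (F X (G X)) ≡ true

IsConsequence : ∀ {n m s} → (Vec Bool n → Vec Bool m → Vec Bool s) →
                (Vec Bool s → Bool) → (Vec Bool n → Bool) → (Vec Bool n → Vec Bool m) → Set
IsConsequence F Ω W G = ∀ X → W X ≡ true → ∀ U → Ω (F X U) ≡ true → U ≡ G X

-- Column X of M_G is the unit vector δ_{2^m}^{G(X)}, so M_G is the 0–1 indicator matrix
-- of the graph of G, while T_Ω is the indicator matrix of the admissible relation
-- {(X, U) | F(X, U) ∈ Ω}.  Since the state ↦ column correspondence is onto, entrywise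
-- comparison of two indicator matrices on the columns in W is exactly inclusion of the
-- two relations over W: (i) says graph G ⊆ admissible, (ii) says admissible ⊆ graph G.
module Submission where

open import Defs
open import Data.Bool using (Bool; true; false; _∧_; _≟_)
open import Data.Nat using (ℕ; suc; _^_; _*_; _≤_; z≤n; s≤s)
open import Data.Nat.Properties using (*-identityˡ)
open import Data.Fin using (Fin; zero; suc; combine; remQuot)
open import Data.Fin.Properties using (remQuot-combine)
open import Data.Product using (_×_; _,_; proj₁; proj₂)
open import Data.Vec using (Vec; []; _∷_)
open import Data.Vec.Properties using (≡-dec)
open import Function.Bundles using (_⇔_; mk⇔; Equivalence)
open import Function.Properties.Equivalence using () renaming (trans to ⇔-trans; sym to ⇔-sym)
open import Relation.Binary.Definitions using (DecidableEquality)
open import Relation.Nullary using (Dec; does; yes; contradiction)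
open import Relation.Nullary.Decidable using (dec-true)
open import Relation.Binary.PropositionalEquality
open ≡-Reasoning

_≟ᵥ_ : ∀ {n} → DecidableEquality (Vec Bool n)
_≟ᵥ_ = ≡-dec _≟_

does≡true⇒ : ∀ {p} {P : Set p} (P? : Dec P) → does P? ≡ true → P
does≡true⇒ (yes p) _ = p

val-∧ : ∀ a b → val (a ∧ b) ≡ val a * val b
val-∧ true  b = sym (*-identityˡ (val b))
val-∧ false b = refl

val-≤ : ∀ {a b} → val a ≤ val b ⇔ (a ≡ true → b ≡ true)
val-≤ {true}  {true}  = mk⇔ (λ _ _ → refl) (λ _ → s≤s z≤n)
val-≤ {true}  {false} = mk⇔ (λ ()) (λ h → contradiction (h refl) λ ())
val-≤ {false} {b}     = mk⇔ (λ _ ()) (λ _ → z≤n)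

bit : Fin 2 → Bool
bit zero       = true
bit (suc zero) = false

state-suc : ∀ {n} {i : Fin (2 ^ suc n)} {a r} →
            remQuot {2} (2 ^ n) i ≡ (a , r) → state {suc n} i ≡ bit a ∷ state r
state-suc {n} {i} eq with remQuot {2} (2 ^ n) i
state-suc refl | zero     , r = refl
state-suc refl | suc zero , r = refl

index : ∀ {n} → Vec Bool n → Fin (2 ^ n)
index []                  = zero
index {suc n} (true  ∷ X) = combine {2} {2 ^ n} zero (index X)
index {suc n} (false ∷ X) = combine {2} {2 ^ n} (suc zero) (index X)

state-index : ∀ {n} (X : Vec Bool n) → state (index X) ≡ X
state-index []            = refl
state-index {suc n} (true ∷ X) =
  trans (state-suc {n} (remQuot-combine {2} {2 ^ n} zero (index X))) (cong (true ∷_) (state-index X))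
state-index {suc n} (false ∷ X) =
  trans (state-suc {n} (remQuot-combine {2} {2 ^ n} (suc zero) (index X))) (cong (false ∷_) (state-index X))

vecForm-∷ : ∀ {n} b (X : Vec Bool n) {i a r} → remQuot {2} (2 ^ n) i ≡ (a , r) →
            vecForm {suc n} (b ∷ X) i ≡ vecForm₁ b a * vecForm X r
vecForm-∷ b X eq = cong (λ (a , r) → vecForm₁ b a * vecForm X r) eq

vecForm₁-bit : ∀ b a → vecForm₁ b a ≡ val (does (bit a ≟ b))
vecForm₁-bit true  zero       = refl
vecForm₁-bit true  (suc zero) = refl
vecForm₁-bit false zero       = refl
vecForm₁-bit false (suc zero) = refl

vecForm-state : ∀ {n} (X : Vec Bool n) i → vecForm X i ≡ val (does (state i ≟ᵥ X))
vecForm-state []      zero = refl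
vecForm-state {suc n} (b ∷ X) i = begin
  vecForm (b ∷ X) i
    ≡⟨ vecForm-∷ b X {i} refl ⟩
  vecForm₁ b a * vecForm X r
    ≡⟨ cong₂ _*_ (vecForm₁-bit b a) (vecForm-state X r) ⟩
  val (does (bit a ≟ b)) * val (does (state r ≟ᵥ X))
    ≡⟨ val-∧ (does (bit a ≟ b)) _ ⟨
  val (does ((bit a ∷ state {n} r) ≟ᵥ (b ∷ X)))
    ≡⟨ cong (λ (Y : Vec Bool (suc n)) → val (does (Y ≟ᵥ (b ∷ X)))) (state-suc {n} {i} refl) ⟨
  val (does (state {suc n} i ≟ᵥ (b ∷ X)))
    ∎
  where
  a = proj₁ (remQuot {2} (2 ^ n) i)
  r = proj₂ (remQuot {2} (2 ^ n) i)

graph : ∀ {n m} → (Vec Bool n → Vec Bool m) → Vec Bool n → Vec Bool m → Bool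
graph G X U = does (U ≟ᵥ G X)

indicatorMatrix : ∀ {n m} → (Vec Bool n → Vec Bool m → Bool) → Fin (2 ^ m) → Fin (2 ^ n) → ℕ
indicatorMatrix R i j = val (R (state j) (state i))

structMatrix-graph : ∀ {n m} (G : Vec Bool n → Vec Bool m) i j →
                     structMatrix G i j ≡ indicatorMatrix (graph G) i j
structMatrix-graph G i j = vecForm-state (G (state j)) i

≤-on-cong : ∀ {n m} {A A′ B B′ : Fin (2 ^ m) → Fin (2 ^ n) → ℕ} {W : Vec Bool n → Bool} →
            (∀ i j → A i j ≡ A′ i j) → (∀ i j → B i j ≡ B′ i j) →
            _≤_on_ {n} {m} A B W ⇔ _≤_on_ {n} {m} A′ B′ W
≤-on-cong A≗A′ B≗B′ = mk⇔
  (λ h i j w → subst₂ _≤_ (A≗A′ i j) (B≗B′ i j) (h i j w))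
  (λ h i j w → subst₂ _≤_ (sym (A≗A′ i j)) (sym (B≗B′ i j)) (h i j w))

≤-on-indicatorMatrix : ∀ {n m} (R S : Vec Bool n → Vec Bool m → Bool) (W : Vec Bool n → Bool) →
                       _≤_on_ {n} {m} (indicatorMatrix R) (indicatorMatrix S) W
                       ⇔ (∀ X → W X ≡ true → ∀ U → R X U ≡ true → S X U ≡ true)
≤-on-indicatorMatrix {n} {m} R S W = mk⇔ to from
  where
  to : _≤_on_ {n} {m} (indicatorMatrix R) (indicatorMatrix S) W →
       ∀ X → W X ≡ true → ∀ U → R X U ≡ true → S X U ≡ true
  to h X w U = Equivalence.to val-≤
    (subst₂ (λ X′ U′ → val (R X′ U′) ≤ val (S X′ U′)) (state-index X) (state-index U)
      (h (index U) (index X) (subst (λ X′ → W X′ ≡ true) (sym (state-index X)) w)))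

  from : (∀ X → W X ≡ true → ∀ U → R X U ≡ true → S X U ≡ true) →
         _≤_on_ {n} {m} (indicatorMatrix R) (indicatorMatrix S) W
  from h i j w = Equivalence.from val-≤ (h (state j) w (state i))

module _ {n m s} (F : Vec Bool n → Vec Bool m → Vec Bool s) (Ω : Vec Bool s → Bool)
         (W : Vec Bool n → Bool) (G : Vec Bool n → Vec Bool m) where

  isAntecedence⇔ : IsAntecedence F Ω W G ⇔
                   (∀ X → W X ≡ true → ∀ U → graph G X U ≡ true → Ω (F X U) ≡ true)
  isAntecedence⇔ = mk⇔
    (λ h X w U U≡GX → subst (λ V → Ω (F X V) ≡ true) (sym (does≡true⇒ (U ≟ᵥ G X) U≡GX)) (h X w))
    (λ h X w → h X w (G X) (dec-true (G X ≟ᵥ G X) refl))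

  isConsequence⇔ : IsConsequence F Ω W G ⇔
                   (∀ X → W X ≡ true → ∀ U → Ω (F X U) ≡ true → graph G X U ≡ true)
  isConsequence⇔ = mk⇔
    (λ h X w U ok → dec-true (U ≟ᵥ G X) (h X w U ok))
    (λ h X w U ok → does≡true⇒ (U ≟ᵥ G X) (h X w U ok))

theorem3p1p3 : ∀ {n m s} (F : Vec Bool n → Vec Bool m → Vec Bool s)
    (Ω : Vec Bool s → Bool) (W : Vec Bool n → Bool) (G : Vec Bool n → Vec Bool m) →
    (IsAntecedence F Ω W G ⇔ (_≤_on_ {n} {m} (structMatrix G) (truthMatrix F Ω) W))
    × (IsConsequence F Ω W G ⇔ (_≤_on_ {n} {m} (truthMatrix F Ω) (structMatrix G) W))
theorem3p1p3 {n} {m} F Ω W G = antecedence , consequence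
  where
  admissible : Vec Bool n → Vec Bool m → Bool
  admissible X U = Ω (F X U)

  truthMatrix-admissible : ∀ i j → truthMatrix F Ω i j ≡ indicatorMatrix admissible i j
  truthMatrix-admissible _ _ = refl

  antecedence : IsAntecedence F Ω W G ⇔ _≤_on_ {n} {m} (structMatrix G) (truthMatrix F Ω) W
  antecedence = ⇔-trans (isAntecedence⇔ F Ω W G) (⇔-sym (⇔-trans
    (≤-on-cong {n} {m} {W = W} (structMatrix-graph G) truthMatrix-admissible)
    (≤-on-indicatorMatrix (graph G) admissible W)))

  consequence : IsConsequence F Ω W G ⇔ _≤_on_ {n} {m} (truthMatrix F Ω) (structMatrix G) W
  consequence = ⇔-trans (isConsequence⇔ F Ω W G) (⇔-sym (⇔-trans
    (≤-on-cong {n} {m} {W = W} truthMatrix-admissible (structMatrix-graph G))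
    (≤-on-indicatorMatrix admissible (graph G) W)))
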